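{- For a positive integer $n$, let $z(n)$ be the largest integer with $3z(n)<2n$, let $m(n)$ be the largest integer with $m(n)^2\le 2n$, and put $$Y(n)=2n-2z(n)+2-m(n)+(1-m(n))\log_2 n .$$ If $n$ is a positive integer with $Y(n)<0$, then $5\le n\le 379$. -}

module Defs where

open import Data.Nat as ℕ using (ℕ; _*_; _^_; _<_; _≤_)
open import Data.Integer as ℤ using (ℤ; +_; _-_)
open import Data.Product using (_×_; Σ-syntax)
open import Data.Sum using (_⊎_)
open import Relation.Binary.PropositionalEquality using (_≡_)

-- x is the largest natural number satisfying P
-- (for the predicates used below, 0 always satisfies P when n ≥ 1,
--  so "largest integer" and "largest natural number" coincide)
IsLargest : (ℕ → Set) → ℕ → Set
IsLargest P x = P x × (∀ k → P k → k ≤ x)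

IsZ : ℕ → ℕ → Set
IsZ n z = IsLargest (λ k → 3 * k < 2 * n) z

IsM : ℕ → ℕ → Set
IsM n m = IsLargest (λ k → k * k ≤ 2 * n) m

YA : ℕ → ℕ → ℕ → ℤ
YA n z m = + (2 * n) - + (2 * z) ℤ.+ + 2 - + m

-- Y(n) = A + (1 - m) log₂ n < 0, i.e. A < (m - 1) log₂ n, for n ≥ 1, m ≥ 1.
-- Exact real-free encoding: either A < 0 (then Y ≤ A < 0 since
-- (m-1) log₂ n ≥ 0), or A = a ≥ 0 and a < (m-1) log₂ n ⇔ 2^a < n^(m-1).
YNeg : ℕ → ℕ → ℕ → Set
YNeg n z m = (YA n z m ℤ.< + 0) ⊎ (Σ[ a ∈ ℕ ] (YA n z m ≡ + a × 2 ^ a < n ^ (m ℕ.∸ 1)))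

{-# OPTIONS --safe #-}
module Submission where

-- Put A = 2n + 2 − 2z − m, so that Y(n) < 0 says 2^A < n^(m−1).  Hence for n ≤ 1024 it suffices to compare n^(M−1) with
-- 2^A at upper bounds Z ≥ z, M ≥ m, a finite computation.  For n > 1024 take t with
-- n ≤ 2^t < 2n; then t ≥ 11, so 9(t+1)² ≤ 2^t < 2n and, as m² ≤ 2n, 3(t+1)m ≤ 2n.  With
-- 6z < 4n this gives t(m−1) ≤ A, whence n^(m−1) ≤ 2^(t(m−1)) ≤ 2^A.

open import Defs
open import Data.Nat using (ℕ; _≤_)
open import Data.Product using (_×_)

open import Data.Bool.Base using (if_then_else_)
open import Data.Integer.Base as ℤ using (ℤ; +_; _⊖_)
import Data.Integer.Properties as ℤ
import Data.Integer.Tactic.RingSolver as ℤ-Solver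
open import Data.List.Base using (applyUpTo; _∷_; [])
open import Data.List.Membership.Propositional.Properties using (∈-applyUpTo⁺)
open import Data.List.Relation.Unary.All as All using (All)
open import Data.Nat.Base
  using (zero; suc; _+_; _*_; _^_; _∸_; _<_; _/_; _≤ᵇ_; z≤n; s≤s; s≤s⁻¹; NonZero; >-nonZero)
open import Data.Nat.Properties
open import Data.Nat.Tactic.RingSolver using (solve)
open import Data.Product using (_,_; ∃-syntax)
open import Data.Sum using (_⊎_; inj₁; inj₂)
open import Relation.Binary.PropositionalEquality using (_≡_; sym; trans; subst; module ≡-Reasoning)
open import Relation.Nullary using (Dec; yes; no; ¬_)
open import Relation.Nullary.Decidable using (_×-dec_; toWitness)

a-b+c-d≡a+c-[b+d] : ∀ (a b c d : ℤ) → a ℤ.- b ℤ.+ c ℤ.- d ≡ (a ℤ.+ c) ℤ.- (b ℤ.+ d)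
a-b+c-d≡a+c-[b+d] = ℤ-Solver.solve-∀

m*m<n*n⇒m<n : ∀ {m n} → m * m < n * n → m < n
m*m<n*n⇒m<n m²<n² = ≰⇒> (λ n≤m → <⇒≱ m²<n² (*-mono-≤ n≤m n≤m))

m*m≤n*n⇒m≤n : ∀ {m n} → m * m ≤ n * n → m ≤ n
m*m≤n*n⇒m≤n m²≤n² = ≮⇒≥ (λ n<m → <⇒≱ (*-mono-< n<m n<m) m²≤n²)

3*m≤m*m+2 : ∀ m → 3 * m ≤ m * m + 2
3*m≤m*m+2 0 = z≤n
3*m≤m*m+2 1 = ≤-refl
3*m≤m*m+2 2 = ≤-refl
3*m≤m*m+2 m@(suc (suc (suc _))) =
  ≤-trans (*-monoˡ-≤ m {3} {m} (s≤s (s≤s (s≤s z≤n)))) (m≤m+n (m * m) 2)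

power-of-two-between : ∀ {n} → 1 ≤ n → ∃[ t ] (n ≤ 2 ^ t × 2 ^ t < 2 * n)
power-of-two-between {1} _ = 0 , ≤-refl , s≤s (s≤s z≤n)
power-of-two-between {suc (suc k)} _ with power-of-two-between {suc k} (s≤s z≤n)
... | t , n≤2^t , 2^t<2n with m≤n⇒m<n∨m≡n n≤2^t
...   | inj₁ n<2^t = t , n<2^t , <-≤-trans 2^t<2n (*-monoʳ-≤ 2 (n≤1+n (suc k)))
...   | inj₂ n≡2^t = suc t
                 , subst (λ x → suc x ≤ 2 ^ suc t) (sym n≡2^t) (^-monoʳ-< 2 (s≤s (s≤s z≤n)) (n<1+n t))
                 , subst (λ x → 2 ^ suc t < 2 * suc x) (sym n≡2^t) (*-monoʳ-< 2 (n<1+n (2 ^ t)))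

9*[1+t]²≤2^t : ∀ {t} → 11 ≤ t → 9 * (suc t * suc t) ≤ 2 ^ t
9*[1+t]²≤2^t {t} 11≤t =
  subst (λ t → 9 * (suc t * suc t) ≤ 2 ^ t) (m+[n∸m]≡n 11≤t) (from-11 (t ∸ 11))
  where
  open ≤-Reasoning
  from-11 : ∀ u → 9 * ((12 + u) * (12 + u)) ≤ 2 ^ (11 + u)
  from-11 zero    = ≤ᵇ⇒≤ 1296 2048 _
  from-11 (suc u) = begin
    9 * ((13 + u) * (13 + u))                              ≤⟨ m≤m+n _ _ ⟩
    9 * ((13 + u) * (13 + u)) + 9 * (u * u + 22 * u + 119) ≡⟨ solve (u ∷ []) ⟩
    2 * (9 * ((12 + u) * (12 + u)))                        ≤⟨ *-monoʳ-≤ 2 (from-11 u) ⟩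
    2 * 2 ^ (11 + u)                                       ∎

All-applyUpTo-range : ∀ {p} {P : ℕ → Set p} {lo k n} →
                      All P (applyUpTo (_+_ lo) k) → lo ≤ n → n < lo + k → P n
All-applyUpTo-range {P = P} {lo} {k} {n} ps lo≤n n<lo+k =
  subst P (m+[n∸m]≡n lo≤n) (All.lookup ps (∈-applyUpTo⁺ (_+_ lo) n∸lo<k))
  where
  n∸lo<k : n ∸ lo < k
  n∸lo<k = subst (n ∸ lo <_) (m+n∸m≡n lo k) (∸-monoˡ-< n<lo+k lo≤n)

record Admissible (n z m : ℕ) : Set where
  constructor admissible
  field
    3z<2n : 3 * z < 2 * n
    m²≤2n : m * m ≤ 2 * n

YAℕ : ℕ → ℕ → ℕ → ℕ
YAℕ n z m = 2 * n + 2 ∸ (2 * z + m)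

YNonNeg : ℕ → ℕ → ℕ → Set
YNonNeg n z m = n ^ (m ∸ 1) ≤ 2 ^ YAℕ n z m

YA≡+YAℕ : ∀ {n z m} → 2 * z + m ≤ 2 * n + 2 → YA n z m ≡ + YAℕ n z m
YA≡+YAℕ {n} {z} {m} le = begin
  YA n z m                          ≡⟨ a-b+c-d≡a+c-[b+d] (+ (2 * n)) (+ (2 * z)) (+ 2) (+ m) ⟩
  + (2 * n + 2) ℤ.- + (2 * z + m)   ≡⟨ ℤ.m-n≡m⊖n (2 * n + 2) (2 * z + m) ⟩
  (2 * n + 2) ⊖ (2 * z + m)         ≡⟨ ℤ.⊖-≥ le ⟩
  + YAℕ n z m                       ∎
  where open ≡-Reasoning

2*z+k≤2*n : ∀ {n z k} → 3 * z < 2 * n → 3 * k ≤ 2 * n + 2 → 2 * z + k ≤ 2 * n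
2*z+k≤2*n {n} {z} {k} 3z<2n 3k≤2n+2 = *-cancelˡ-≤ 3 (+-cancelʳ-≤ 2 _ _ (begin
  3 * (2 * z + k) + 2         ≡⟨ solve (z ∷ k ∷ []) ⟩
  2 * (1 + 3 * z) + 3 * k     ≤⟨ +-mono-≤ (*-monoʳ-≤ 2 3z<2n) 3k≤2n+2 ⟩
  2 * (2 * n) + (2 * n + 2)   ≡⟨ solve (n ∷ []) ⟩
  3 * (2 * n) + 2             ∎))
  where open ≤-Reasoning

2*z+m≤2*n : ∀ {n z m} → Admissible n z m → 2 * z + m ≤ 2 * n
2*z+m≤2*n {n} {z} {m} (admissible 3z<2n m²≤2n) =
  2*z+k≤2*n {n} {z} {m} 3z<2n (≤-trans (3*m≤m*m+2 m) (+-monoˡ-≤ 2 m²≤2n))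

YNonNeg⇒¬YNeg : ∀ {n z m} → Admissible n z m → YNonNeg n z m → ¬ YNeg n z m
YNonNeg⇒¬YNeg {n} {z} {m} adm Y≥0 = λ where
    (inj₁ YA<0)                     → ℤ.+≮0 (subst (ℤ._< + 0) YA≡ YA<0)
    (inj₂ (a , YA≡a , 2^a<n^[m∸1])) →
      <⇒≱ 2^a<n^[m∸1] (subst (λ b → n ^ (m ∸ 1) ≤ 2 ^ b) (YAℕ≡a YA≡a) Y≥0)
  where
  YA≡ : YA n z m ≡ + YAℕ n z m
  YA≡ = YA≡+YAℕ {n} {z} {m} (≤-trans (2*z+m≤2*n adm) (m≤m+n _ 2))
  YAℕ≡a : ∀ {a} → YA n z m ≡ + a → YAℕ n z m ≡ a
  YAℕ≡a YA≡a = ℤ.+-injective (trans (sym YA≡) YA≡a)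

YNonNeg-anti : ∀ {n z m Z M} .{{_ : NonZero n}} →
               z ≤ Z → m ≤ M → YNonNeg n Z M → YNonNeg n z m
YNonNeg-anti {n} {z} {m} {Z} {M} z≤Z m≤M Y≥0 = begin
  n ^ (m ∸ 1)     ≤⟨ ^-monoʳ-≤ n (∸-monoˡ-≤ 1 m≤M) ⟩
  n ^ (M ∸ 1)     ≤⟨ Y≥0 ⟩
  2 ^ YAℕ n Z M   ≤⟨ ^-monoʳ-≤ 2 (∸-monoʳ-≤ (2 * n + 2) (+-mono-≤ (*-monoʳ-≤ 2 z≤Z) m≤M)) ⟩
  2 ^ YAℕ n z m   ∎
  where open ≤-Reasoning

⌊√_⌋ : ℕ → ℕ
⌊√ x ⌋ = search x
  where
  search : ℕ → ℕ
  search zero    = zero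
  search (suc k) = if suc k * suc k ≤ᵇ x then suc k else search k

Certified : ℕ → Set
Certified n = 2 * n ≤ 3 * suc Z × 2 * n < suc M * suc M × YNonNeg n Z M
  where
  Z = 2 * n / 3
  M = ⌊√ (2 * n) ⌋

certified? : ∀ n → Dec (Certified n)
certified? n = _ ≤? _ ×-dec _ <? _ ×-dec _ ≤? _

-- The first two conditions make Z and M upper bounds for every admissible z and m,
-- so nothing needs to be known about _/_ and ⌊√_⌋.
Certified⇒YNonNeg : ∀ {n z m} .{{_ : NonZero n}} →
                    Admissible n z m → Certified n → YNonNeg n z m
Certified⇒YNonNeg {n} {z} {m} (admissible 3z<2n m²≤2n) (2n≤3[Z+1] , 2n<[M+1]² , Y≥0) =
  YNonNeg-anti {n} {z} {m} (s≤s⁻¹ (*-cancelˡ-< 3 _ _ (<-≤-trans 3z<2n 2n≤3[Z+1])))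
                           (s≤s⁻¹ (m*m<n*n⇒m<n (≤-<-trans m²≤2n 2n<[M+1]²)))
                           Y≥0

certified-1-4 : All Certified (applyUpTo (_+_ 1) 4)
certified-1-4 = toWitness {a? = All.all? certified? _} _

certified-380-1024 : All Certified (applyUpTo (_+_ 380) 645)
certified-380-1024 = toWitness {a? = All.all? certified? _} _

YNonNeg-via-power-of-two : ∀ {n z m} t → n ≤ 2 ^ t → 9 * (suc t * suc t) ≤ 2 * n →
                           Admissible n z m → YNonNeg n z m
YNonNeg-via-power-of-two {n} {z} {m} t n≤2^t 9[1+t]²≤2n (admissible 3z<2n m²≤2n) = begin
  n ^ (m ∸ 1)         ≤⟨ ^-monoˡ-≤ (m ∸ 1) n≤2^t ⟩
  (2 ^ t) ^ (m ∸ 1)   ≡⟨ ^-*-assoc 2 t (m ∸ 1) ⟩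
  2 ^ (t * (m ∸ 1))   ≤⟨ ^-monoʳ-≤ 2 (m+n≤o⇒m≤o∸n (t * (m ∸ 1)) t[m∸1]+[2z+m]≤2n+2) ⟩
  2 ^ YAℕ n z m       ∎
  where
  open ≤-Reasoning
  3[1+t]m≤2n : 3 * (suc t * m) ≤ 2 * n
  3[1+t]m≤2n = m*m≤n*n⇒m≤n (begin
    3 * (suc t * m) * (3 * (suc t * m)) ≡⟨ solve (t ∷ m ∷ []) ⟩
    9 * (suc t * suc t) * (m * m)       ≤⟨ *-mono-≤ 9[1+t]²≤2n m²≤2n ⟩
    2 * n * (2 * n)                     ∎)
  3[1+t]m≤2n+2 : 3 * (suc t * m) ≤ 2 * n + 2
  3[1+t]m≤2n+2 = ≤-trans 3[1+t]m≤2n (m≤m+n _ 2)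
  t[m∸1]+[2z+m]≤2n+2 : t * (m ∸ 1) + (2 * z + m) ≤ 2 * n + 2
  t[m∸1]+[2z+m]≤2n+2 = begin
    t * (m ∸ 1) + (2 * z + m) ≤⟨ +-monoˡ-≤ (2 * z + m) (*-monoʳ-≤ t (m∸n≤m m 1)) ⟩
    t * m + (2 * z + m)       ≡⟨ solve (t ∷ z ∷ m ∷ []) ⟩
    2 * z + suc t * m         ≤⟨ 2*z+k≤2*n {n} {z} {suc t * m} 3z<2n 3[1+t]m≤2n+2 ⟩
    2 * n                     ≤⟨ m≤m+n _ 2 ⟩
    2 * n + 2                 ∎

YNonNeg-beyond-1024 : ∀ {n z m} → 1024 < n → Admissible n z m → YNonNeg n z m
YNonNeg-beyond-1024 {n} 1024<n adm with power-of-two-between (≤-trans (s≤s z≤n) 1024<n)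
... | t , n≤2^t , 2^t<2n =
  YNonNeg-via-power-of-two t n≤2^t (≤-trans (9*[1+t]²≤2^t 11≤t) (<⇒≤ 2^t<2n)) adm
  where
  11≤t : 11 ≤ t
  11≤t = ≮⇒≥ (λ t<11 → <⇒≱ 1024<n (≤-trans n≤2^t (^-monoʳ-≤ 2 (s≤s⁻¹ t<11))))

YNonNeg-outside : ∀ {n z m} → 1 ≤ n → n ≤ 4 ⊎ 380 ≤ n → Admissible n z m → YNonNeg n z m
YNonNeg-outside 1≤n (inj₁ n≤4) adm =
  Certified⇒YNonNeg {{>-nonZero 1≤n}} adm
    (All-applyUpTo-range {lo = 1} {k = 4} certified-1-4 1≤n (s≤s n≤4))
YNonNeg-outside {n} 1≤n (inj₂ 380≤n) adm with n ≤? 1024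
... | yes n≤1024 = Certified⇒YNonNeg {{>-nonZero 1≤n}} adm
  (All-applyUpTo-range {lo = 380} {k = 645} certified-380-1024 380≤n (s≤s n≤1024))
... | no  n≰1024 = YNonNeg-beyond-1024 (≰⇒> n≰1024) adm

lemma3p6 : (n : ℕ) → 1 ≤ n → (z m : ℕ) → IsZ n z → IsM n m → YNeg n z m → 5 ≤ n × n ≤ 379
lemma3p6 n 1≤n z m (3z<2n , _) (m²≤2n , _) Y<0 =
  ≮⇒≥ (λ n<5 → excluded (inj₁ (s≤s⁻¹ n<5))) , ≮⇒≥ (λ 379<n → excluded (inj₂ 379<n))
  where
  adm : Admissible n z m
  adm = admissible 3z<2n m²≤2n
  excluded : ¬ (n ≤ 4 ⊎ 380 ≤ n)
  excluded outside = YNonNeg⇒¬YNeg adm (YNonNeg-outside 1≤n outside adm) Y<0
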